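{- The ideal $I$ is generated (as a two-sided ideal of $\mathcal U$) by the elements $u_x-u_y$ for words $x,y$ in $\mathbf N$ such that $\alpha(x)=\alpha(y)$ and $w(x)=w(y)$.
   Context: The Schur operator $u_i$ ($i\ge1$) acts linearly on the vector space $\mathbf C[\mathbf Y]$ with basis all partitions by $u_i(\lambda)=\mu$ if the Young diagram of $\mu$ is obtained from that of $\lambda$ by adding one box in column $i$ and $\mu$ is a partition, and $u_i(\lambda)=0$ otherwise. $\mathcal U$ is the free associative $\mathbf C$-algebra on $u_1,u_2,\dots$, acting on $\mathbf C[\mathbf Y]$ via this action; for a word $x=x_1\cdots x_l$, $u_x=u_{x_1}\cdots u_{x_l}$. $I$ is the two-sided ideal of elements of $\mathcal U$ annihilating $\mathbf C[\mathbf Y]$. The weight $w(x)=(w_1(x),w_2(x),\dots)$, where $w_i(x)$ is the number of occurrences of $i$ in $x$. $\alpha(x)=(\alpha_1(x),\alpha_2(x),\dots)$ with $\alpha_i(x)=\max\{w_{i+1}(\tilde x)-w_i(\tilde x):\tilde x\text{ a suffix of }x\}$, where a suffix is a trailing subword $x_j\cdots x_l$, possibly empty. -}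

module Defs where

open import Level using (Level; _⊔_) renaming (suc to lsuc)
open import Data.Nat as ℕ using (ℕ; zero; suc; _<_; _<?_)
open import Data.Nat.Properties using () renaming (_≟_ to _≟ℕ_)
open import Data.Integer as ℤ using (ℤ; _⊖_) renaming (_⊔_ to _⊔ℤ_)
open import Data.List using (List; []; _∷_; _++_; map; concatMap; foldr; tails; filter)
open import Data.List.Properties using () renaming (≡-dec to ≡-decList)
open import Data.List.Relation.Unary.All using (All)
open import Data.List.Relation.Unary.Linked using (Linked)
open import Data.Maybe using (Maybe; just; nothing; _>>=_)
import Data.Maybe as Maybe
open import Data.Maybe.Properties using () renaming (≡-dec to ≡-decMaybe)
open import Data.Product using (_×_; _,_; ∃; ∃-syntax; proj₁; proj₂)
open import Relation.Nullary using (¬_; Dec; yes; no)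
open import Relation.Binary.PropositionalEquality using (_≡_)
open import Algebra.Bundles using (CommutativeRing)

ringFromℕ : ∀ {c ℓ} (R : CommutativeRing c ℓ) → ℕ → CommutativeRing.Carrier R
ringFromℕ R zero    = CommutativeRing.0# R
ringFromℕ R (suc n) = CommutativeRing._+_ R (CommutativeRing.1# R) (ringFromℕ R n)

record Char0Field (c ℓ : Level) : Set (lsuc (c ⊔ ℓ)) where
  field
    cring : CommutativeRing c ℓ
  open CommutativeRing cring public hiding (ring)
  field
    nontrivial : ¬ (1# ≈ 0#)
    inverse    : ∀ x → ¬ (x ≈ 0#) → ∃[ y ] (x * y ≈ 1#)
    char0      : ∀ n → ringFromℕ cring n ≈ 0# → n ≡ 0

-- Words and letters.
-- CONVENTION: the letter k : ℕ stands for the Schur operator u_{k+1}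
-- (i.e. column k+1), so words in {1,2,...} are lists of ℕ shifted by one.

Word : Set
Word = List ℕ

IsPartition : List ℕ → Set
IsPartition λ′ = All (0 <_) λ′ × Linked ℕ._≥_ λ′

-- add one box in column (k+1); nothing if the result is not a partition.
-- Rows whose part is ≥ k+1 already contain column k+1; the box goes into
-- the first row with part ≤ k, which must have part exactly k.
addBox : ℕ → List ℕ → Maybe (List ℕ)
addBox zero    []       = just (1 ∷ [])
addBox (suc k) []       = nothing
addBox k       (p ∷ ps) with k <? p
... | yes _ = Maybe.map (p ∷_) (addBox k ps)
... | no  _ with p ≟ℕ k
...   | yes _ = just (suc k ∷ ps)
...   | no  _ = nothing

-- u_x = u_{x₁} ⋯ u_{xₗ}: the last letter acts first.
-- act x λ = just μ  means  u_x λ = μ ; nothing means u_x λ = 0.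
act : Word → List ℕ → Maybe (List ℕ)
act []      λ′ = just λ′
act (a ∷ x) λ′ = act x λ′ >>= addBox a

-- Weight and α.  (Shifted: w k x = w_{k+1}(x), α k x = α_{k+1}(x).)

count : ℕ → Word → ℕ
count k []      = 0
count k (a ∷ x) with a ≟ℕ k
... | yes _ = suc (count k x)
... | no  _ = count k x

w : ℕ → Word → ℕ
w = count

α : ℕ → Word → ℤ
α k x = foldr (λ s m → (count (suc k) s ⊖ count k s) ⊔ℤ m) (ℤ.+ 0) (tails x)

module Over {c ℓ : Level} (K : Char0Field c ℓ) where
  open Char0Field K

  -- an element of 𝒰 as a formal finite sum  Σ c_j u_{x_j}
  U : Set c
  U = List (Carrier × Word)

  ΣK : List Carrier → Carrier
  ΣK = foldr _+_ 0#

  coeff : U → Word → Carrier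
  coeff f x = ΣK (map proj₁ (filter (λ p → ≡-decList _≟ℕ_ (proj₂ p) x) f))

  -- equality in 𝒰 (the free module on words)
  _≈U_ : U → U → Set ℓ
  f ≈U g = ∀ x → coeff f x ≈ coeff g x

  _+U_ : U → U → U
  f +U g = f ++ g

  _*U_ : U → U → U
  f *U g = concatMap (λ p → map (λ q → (proj₁ p * proj₁ q , proj₂ p ++ proj₂ q)) g) f

  0U : U
  0U = []

  uw : Word → U
  uw x = (1# , x) ∷ []

  diff : Word → Word → U
  diff x y = (1# , x) ∷ (- 1# , y) ∷ []

  -- coefficient of the basis vector μ in f · λ
  actCoeff : U → List ℕ → List ℕ → Carrier
  actCoeff f λ′ μ =
    ΣK (map proj₁ (filter (λ p → ≡-decMaybe (≡-decList _≟ℕ_) (act (proj₂ p) λ′) (just μ)) f))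

  InI : U → Set (ℓ)
  InI f = ∀ λ′ → IsPartition λ′ → ∀ μ → IsPartition μ → actCoeff f λ′ μ ≈ 0#

  data Ideal (S : U → Set (c ⊔ ℓ)) : U → Set (c ⊔ ℓ) where
    gen  : ∀ {f} → S f → Ideal S f
    zer  : Ideal S 0U
    add  : ∀ {f g} → Ideal S f → Ideal S g → Ideal S (f +U g)
    lmul : ∀ {f} (a : U) → Ideal S f → Ideal S (a *U f)
    rmul : ∀ {f} (b : U) → Ideal S f → Ideal S (f *U b)
    resp : ∀ {f g} → f ≈U g → Ideal S f → Ideal S g

  Gen : U → Set (c ⊔ ℓ)
  Gen f = Level.Lift (c ⊔ ℓ)
    (∃[ x ] ∃[ y ] ((∀ i → α i x ≡ α i y) × (∀ i → w i x ≡ w i y) × f ≡ diff x y))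

module Submission where

-- Module Shapes describes u_x λ through the column lengths λ'_k of λ:
-- u_x λ ≠ 0 iff α_k(x) ≤ λ'_k − λ'_{k+1} for all k, and then u_x λ is the
-- partition with column lengths λ'_k + w_k(x); partitions are determined by their
-- column lengths.  So u_x, u_y act identically when α and w agree, and as I is an
-- ideal, the ideal generated by these differences lies in I.  Conversely, let Λ_x
-- be the partition with λ'_k − λ'_{k+1} = α_k(x).  If u_y Λ_x = u_x Λ_x then
-- w(y) = w(x) and α(y) ≤ α(x) pointwise.  For f ∈ I pick a term u_x of f with
-- Σ_k α_k(x) minimal: the terms u_y with u_y Λ_x = u_x Λ_x have α(y) = α(x),
-- w(y) = w(x), and coefficients summing to 0 since f Λ_x = 0, so they form
-- Σ c_y (u_y − u_x), an element of the ideal; the other terms form a shorter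
-- element of I, and induction on the number of terms concludes (module Annihilator).

open import Defs
open import Level using (Level)
open import Data.Product using (_×_; _,_)

module Shapes where

  open import Data.Nat as ℕ using (ℕ; zero; suc; _+_; _∸_; _≤_; _<_; z≤n; s≤s; _<?_; _≤?_)
  open import Data.Nat.Properties
  open import Data.Integer using (_⊖_; +_; +≤+; ∣_∣) renaming (_≤_ to _≤ℤ_)
  import Data.Integer.Properties as ℤP
  open import Data.List using (List; []; _∷_; _++_; map; replicate; length)
  open import Data.List.Properties using (length-++; length-map; length-replicate)
  open import Data.List.Relation.Unary.All as All using (All; []; _∷_)
  open import Data.List.Relation.Unary.Linked as Linked using (Linked; []; [-]; _∷_)
  open import Data.Maybe using (Maybe; just; nothing; _>>=_)
  import Data.Maybe as Maybe
  open import Data.Product using (_,_; proj₁; proj₂; ∃)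
  open import Data.Sum using (inj₁; inj₂)
  open import Data.Unit using (⊤; tt)
  open import Data.Empty using (⊥-elim)
  open import Relation.Nullary using (¬_; Dec; yes; no)
  open import Relation.Binary.Definitions using (tri<; tri≈; tri>)
  open import Relation.Binary.PropositionalEquality

  -- colLen j λ is the length of column j+1 of λ (the letter j names column j+1).
  colLen : ℕ → List ℕ → ℕ
  colLen j [] = 0
  colLen j (p ∷ ps) with j <? p
  ... | yes _ = suc (colLen j ps)
  ... | no _ = colLen j ps

  colLen-< : ∀ {j p} ps → j < p → colLen j (p ∷ ps) ≡ suc (colLen j ps)
  colLen-< {j} {p} ps j<p with j <? p
  ... | yes _ = refl
  ... | no j≮p = ⊥-elim (j≮p j<p)

  colLen-≮ : ∀ {j p} ps → ¬ j < p → colLen j (p ∷ ps) ≡ colLen j ps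
  colLen-≮ {j} {p} ps j≮p with j <? p
  ... | yes j<p = ⊥-elim (j≮p j<p)
  ... | no _ = refl

  colLen-short : ∀ {j} ps → All (_≤ j) ps → colLen j ps ≡ 0
  colLen-short [] [] = refl
  colLen-short (p ∷ ps) (p≤j ∷ ps≤j) = trans (colLen-≮ ps (≤⇒≯ p≤j)) (colLen-short ps ps≤j)

  colLen-antitone : ∀ k ps → colLen (suc k) ps ≤ colLen k ps
  colLen-antitone k [] = z≤n
  colLen-antitone k (p ∷ ps) with suc k <? p | k <? p
  ... | yes _ | yes _ = s≤s (colLen-antitone k ps)
  ... | yes 1+k<p | no k≮p = ⊥-elim (k≮p (<-trans (n<1+n k) 1+k<p))
  ... | no _ | yes _ = m≤n⇒m≤1+n (colLen-antitone k ps)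
  ... | no _ | no _ = colLen-antitone k ps

  head-bounds : ∀ {p ps} → Linked ℕ._≥_ (p ∷ ps) → All (_≤ p) ps
  head-bounds {ps = []} _ = []
  head-bounds {ps = q ∷ qs} (q≤p ∷ lk) = q≤p ∷ All.map (λ r≤q → ≤-trans r≤q q≤p) (head-bounds lk)

  cons-linked : ∀ {n ps} → All (_≤ n) ps → Linked ℕ._≥_ ps → Linked ℕ._≥_ (n ∷ ps)
  cons-linked [] _ = [-]
  cons-linked (q≤n ∷ _) lk = q≤n ∷ lk

  partition-tail : ∀ {p ps} → IsPartition (p ∷ ps) → IsPartition ps
  partition-tail (_ ∷ pos , lk) = pos , Linked.tail lk

  count-∷ : ∀ j a x → count j (a ∷ x) ≡ count j (a ∷ []) + count j x
  count-∷ j a x with a ≟ j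
  ... | yes _ = refl
  ... | no _ = refl

  count-≡ : ∀ k x → count k (k ∷ x) ≡ suc (count k x)
  count-≡ k x with k ≟ k
  ... | yes _ = refl
  ... | no k≢k = ⊥-elim (k≢k refl)

  count-≢ : ∀ {a k} x → ¬ a ≡ k → count k (a ∷ x) ≡ count k x
  count-≢ {a} {k} x a≢k with a ≟ k
  ... | yes a≡k = ⊥-elim (a≢k a≡k)
  ... | no _ = refl

  count-absent : ∀ k x → All (_≤ k) x → count (suc k) x ≡ 0
  count-absent k [] [] = refl
  count-absent k (a ∷ x) (a≤k ∷ x≤k) = trans (count-≢ x (λ a≡1+k → <-irrefl a≡1+k (s≤s a≤k))) (count-absent k x x≤k)

  -- A box can be added in column k+1 of a partition λ iff k = 0 or λ'_{k+1} < λ'_k.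
  CanAdd : ℕ → List ℕ → Set
  CanAdd zero λ′ = ⊤
  CanAdd (suc k) λ′ = colLen (suc k) λ′ < colLen k λ′

  addBox-< : ∀ {k p} ps → k < p → addBox k (p ∷ ps) ≡ Maybe.map (p ∷_) (addBox k ps)
  addBox-< {zero} {p} ps k<p with zero <? p
  ... | yes _ = refl
  ... | no k≮p = ⊥-elim (k≮p k<p)
  addBox-< {suc k} {p} ps k<p with suc k <? p
  ... | yes _ = refl
  ... | no k≮p = ⊥-elim (k≮p k<p)

  addBox-≡ : ∀ k ps → addBox k (k ∷ ps) ≡ just (suc k ∷ ps)
  addBox-≡ zero ps = refl
  addBox-≡ (suc k) ps with suc k <? suc k
  ... | yes k<k = ⊥-elim (<-irrefl refl k<k)
  ... | no _ with suc k ≟ suc k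
  ...   | yes _ = refl
  ...   | no k≢k = ⊥-elim (k≢k refl)

  addBox-fail : ∀ {k p} ps → ¬ k < p → ¬ p ≡ k → addBox k (p ∷ ps) ≡ nothing
  addBox-fail {zero} {p} ps k≮p p≢k with zero <? p
  ... | yes k<p = ⊥-elim (k≮p k<p)
  ... | no _ with p ≟ zero
  ...   | yes p≡k = ⊥-elim (p≢k p≡k)
  ...   | no _ = refl
  addBox-fail {suc k} {p} ps k≮p p≢k with suc k <? p
  ... | yes k<p = ⊥-elim (k≮p k<p)
  ... | no _ with p ≟ suc k
  ...   | yes p≡k = ⊥-elim (p≢k p≡k)
  ...   | no _ = refl

  map-∷-just : ∀ {p : ℕ} (mb : Maybe (List ℕ)) {μ} → Maybe.map (p ∷_) mb ≡ just μ →
    ∃ λ μ′ → mb ≡ just μ′ × μ ≡ p ∷ μ′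
  map-∷-just (just μ′) refl = μ′ , refl , refl

  addBox-bounded : ∀ {n} k ps {μ} → All (_≤ n) ps → k < n → addBox k ps ≡ just μ → All (_≤ n) μ
  addBox-bounded zero [] _ k<n refl = k<n ∷ []
  addBox-bounded k (p ∷ ps) (p≤n ∷ ps≤n) k<n eq with k <? p
  ... | yes k<p with map-∷-just (addBox k ps) (trans (sym (addBox-< ps k<p)) eq)
  ...   | _ , eq′ , refl = p≤n ∷ addBox-bounded k ps ps≤n k<n eq′
  addBox-bounded k (p ∷ ps) (p≤n ∷ ps≤n) k<n eq | no k≮p with p ≟ k
  ...   | yes refl with refl ← trans (sym (addBox-≡ p ps)) eq = k<n ∷ ps≤n
  ...   | no p≢k with () ← trans (sym (addBox-fail ps k≮p p≢k)) eq

  -- A row longer than k contributes one box to both columns k and k+1.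
  canAdd-∷ : ∀ k {p} ps → k < p → CanAdd k ps → CanAdd k (p ∷ ps)
  canAdd-∷ zero ps k<p ok = tt
  canAdd-∷ (suc k) ps k<p ok =
    subst₂ _<_ (sym (colLen-< ps k<p)) (sym (colLen-< ps (<-trans (n<1+n k) k<p))) (s≤s ok)

  canAdd-tail : ∀ k {p} ps → k < p → CanAdd k (p ∷ ps) → CanAdd k ps
  canAdd-tail zero ps k<p ok = tt
  canAdd-tail (suc k) ps k<p ok =
    ≤-pred (subst₂ _<_ (colLen-< ps k<p) (colLen-< ps (<-trans (n<1+n k) k<p)) ok)

  colLen-grow : ∀ k ps → All (_≤ k) ps → ∀ j → colLen j (suc k ∷ ps) ≡ colLen j (k ∷ ps) + count j (k ∷ [])
  colLen-grow k ps ps≤k j with <-cmp j k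
  ... | tri< j<k _ _ = begin
    colLen j (suc k ∷ ps)              ≡⟨ colLen-< ps (m<n⇒m<1+n j<k) ⟩
    suc (colLen j ps)                  ≡⟨ cong suc (sym (+-identityʳ _)) ⟩
    suc (colLen j ps) + 0              ≡⟨ cong₂ _+_ (sym (colLen-< ps j<k)) (sym (count-≢ [] (λ k≡j → <-irrefl (sym k≡j) j<k))) ⟩
    colLen j (k ∷ ps) + count j (k ∷ []) ∎
    where open ≡-Reasoning
  ... | tri≈ _ refl _ = begin
    colLen j (suc j ∷ ps)              ≡⟨ colLen-< ps (n<1+n j) ⟩
    suc (colLen j ps)                  ≡⟨ +-comm 1 _ ⟩
    colLen j ps + 1                    ≡⟨ cong₂ _+_ (sym (colLen-≮ ps (<-irrefl refl))) (sym (count-≡ j [])) ⟩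
    colLen j (j ∷ ps) + count j (j ∷ []) ∎
    where open ≡-Reasoning
  ... | tri> _ _ k<j = begin
    colLen j (suc k ∷ ps)              ≡⟨ colLen-short (suc k ∷ ps) (k<j ∷ All.map (λ p≤k → ≤-trans p≤k (<⇒≤ k<j)) ps≤k) ⟩
    0                                  ≡⟨ sym (cong₂ _+_ (colLen-short (k ∷ ps) (<⇒≤ k<j ∷ All.map (λ p≤k → ≤-trans p≤k (<⇒≤ k<j)) ps≤k))
                                                      (count-≢ [] (λ k≡j → <-irrefl k≡j k<j))) ⟩
    colLen j (k ∷ ps) + count j (k ∷ []) ∎
    where open ≡-Reasoning

  ColumnsAdd : List ℕ → List ℕ → Word → Set
  ColumnsAdd μ λ′ x = ∀ j → colLen j μ ≡ colLen j λ′ + count j x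

  addBox-spec : ∀ k λ′ {μ} → IsPartition λ′ → addBox k λ′ ≡ just μ →
    CanAdd k λ′ × IsPartition μ × ColumnsAdd μ λ′ (k ∷ [])
  addBox-spec-∷ : ∀ k p ps {μ} → IsPartition (p ∷ ps) → addBox k (p ∷ ps) ≡ just μ → Dec (k < p) → Dec (p ≡ k) →
    CanAdd k (p ∷ ps) × IsPartition μ × ColumnsAdd μ (p ∷ ps) (k ∷ [])
  addBox-spec zero [] _ refl = tt , ((s≤s z≤n ∷ []) , [-]) , columns
    where
    columns : ∀ j → colLen j (1 ∷ []) ≡ colLen j [] + count j (0 ∷ [])
    columns zero = refl
    columns (suc j) = trans (colLen-≮ {suc j} {1} [] (λ { (s≤s ()) })) (sym (count-≢ {0} {suc j} [] (λ ())))
  addBox-spec k (p ∷ ps) isP eq = addBox-spec-∷ k p ps isP eq (k <? p) (p ≟ k)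
  addBox-spec-∷ k p ps (p>0 ∷ pos , lk) eq (yes k<p) _ with map-∷-just (addBox k ps) (trans (sym (addBox-< ps k<p)) eq)
  ... | μ′ , eq′ , refl with addBox-spec k ps (pos , Linked.tail lk) eq′
  ...   | ok , (pos′ , lk′) , columns′ =
    canAdd-∷ k ps k<p ok , ((p>0 ∷ pos′) , cons-linked (addBox-bounded k ps (head-bounds lk) k<p eq′) lk′) , columns
    where
    columns : ColumnsAdd (p ∷ μ′) (p ∷ ps) (k ∷ [])
    columns j with j <? p
    ... | yes _ = cong suc (columns′ j)
    ... | no _ = columns′ j
  addBox-spec-∷ k .k ps (_ ∷ pos , lk) eq (no _) (yes refl) with refl ← trans (sym (addBox-≡ k ps)) eq =
    canAdd k (head-bounds lk) , ((s≤s z≤n ∷ pos) , cons-linked (All.map m≤n⇒m≤1+n (head-bounds lk)) (Linked.tail lk)) ,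
    colLen-grow k ps (head-bounds lk)
    where
    canAdd : ∀ k → All (_≤ k) ps → CanAdd k (k ∷ ps)
    canAdd zero _ = tt
    canAdd (suc k) ps≤k = subst₂ _<_ (sym (trans (colLen-≮ ps (<-irrefl refl)) (colLen-short ps ps≤k)))
                            (sym (colLen-< ps (n<1+n k))) (s≤s z≤n)
  addBox-spec-∷ k p ps _ eq (no k≮p) (no p≢k) with () ← trans (sym (addBox-fail ps k≮p p≢k)) eq

  addBox-defined : ∀ k λ′ → IsPartition λ′ → CanAdd k λ′ → ∃ λ μ → addBox k λ′ ≡ just μ
  addBox-defined-∷ : ∀ k p ps → IsPartition (p ∷ ps) → CanAdd k (p ∷ ps) → Dec (k < p) → Dec (p ≡ k) →
    ∃ λ μ → addBox k (p ∷ ps) ≡ just μ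
  addBox-defined zero [] _ _ = _ , refl
  addBox-defined k (p ∷ ps) isP ok = addBox-defined-∷ k p ps isP ok (k <? p) (p ≟ k)
  addBox-defined-∷ k p ps isP ok (yes k<p) _ with addBox-defined k ps (partition-tail isP) (canAdd-tail k ps k<p ok)
  ... | μ′ , eq = p ∷ μ′ , trans (addBox-< ps k<p) (cong (Maybe.map (p ∷_)) eq)
  addBox-defined-∷ k .k ps _ _ (no _) (yes refl) = _ , addBox-≡ k ps
  addBox-defined-∷ zero p ps _ _ (no k≮p) (no p≢k) = ⊥-elim (k≮p (n≢0⇒n>0 p≢k))
  addBox-defined-∷ (suc k) p ps (_ , lk) ok (no k≮p) (no p≢k) = ⊥-elim (n≮0 (subst (colLen (suc k) (p ∷ ps) <_) noColumn ok))
    where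
    p≤k : p ≤ k
    p≤k = ≤-pred (≤∧≢⇒< (≮⇒≥ k≮p) p≢k)
    noColumn : colLen k (p ∷ ps) ≡ 0
    noColumn = colLen-short (p ∷ ps) (p≤k ∷ All.map (λ q≤p → ≤-trans q≤p p≤k) (head-bounds lk))

  ⊖≤⇒≤+ : ∀ m n d → (m ⊖ n) ≤ℤ + d → m ≤ n + d
  ⊖≤⇒≤+ m n d h with n ≤? m
  ... | yes n≤m = ≤-trans (≤-reflexive (sym (m+[n∸m]≡n n≤m)))
                   (+-monoʳ-≤ n (ℤP.drop‿+≤+ (subst (_≤ℤ + d) (ℤP.⊖-≥ n≤m) h)))
  ... | no n≰m = ≤-trans (<⇒≤ (≰⇒> n≰m)) (m≤m+n n d)

  ≤+⇒⊖≤ : ∀ m n d → m ≤ n + d → (m ⊖ n) ≤ℤ + d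
  ≤+⇒⊖≤ m n d h with n ≤? m
  ... | yes n≤m = subst (_≤ℤ + d) (sym (ℤP.⊖-≥ n≤m)) (+≤+ (≤-trans (∸-monoˡ-≤ n h) (≤-reflexive (m+n∸m≡n n d))))
  ... | no n≰m = subst (_≤ℤ + d) (sym (ℤP.⊖-< (≰⇒> n≰m))) ℤP.neg-≤-pos

  α-head : ∀ k x → (count (suc k) x ⊖ count k x) ≤ℤ α k x
  α-head k x = ℤP.i≤i⊔j _ _

  α-tail : ∀ k a x → α k x ≤ℤ α k (a ∷ x)
  α-tail k a x = ℤP.i≤j⊔i _ _

  -- α counts the empty suffix, so it is non-negative.
  α-nonneg : ∀ k x → + 0 ≤ℤ α k x
  α-nonneg k [] = +≤+ z≤n
  α-nonneg k (a ∷ x) = ℤP.≤-trans (α-nonneg k x) (α-tail k a x)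

  α-abs : ∀ k x → + ∣ α k x ∣ ≡ α k x
  α-abs k x = ℤP.0≤i⇒+∣i∣≡i (α-nonneg k x)

  α-vanishes : ∀ k x → All (_≤ k) x → α k x ≡ + 0
  α-vanishes k x x≤k = ℤP.≤-antisym (α≤0 x x≤k) (α-nonneg k x)
    where
    α≤0 : ∀ x → All (_≤ k) x → α k x ≤ℤ + 0
    α≤0 [] [] = +≤+ z≤n
    α≤0 (a ∷ x) all@(_ ∷ x≤k) =
      ℤP.⊔-lub (≤+⇒⊖≤ _ _ 0 (subst (_≤ count k (a ∷ x) + 0) (sym (count-absent k (a ∷ x) all)) z≤n)) (α≤0 x x≤k)

  Fits : Word → List ℕ → Set
  Fits x λ′ = ∀ k → α k x ≤ℤ + (colLen k λ′ ∸ colLen (suc k) λ′)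

  -- For columns c₁ ≤ c₀ of λ, the box condition (c₁ + w₁ < c₀ + w₀) is
  -- w₁ + 1 ≤ w₀ + (c₀ − c₁).
  <-gap⇒ : ∀ {c₀ c₁ w₀ w₁} → c₁ ≤ c₀ → c₁ + w₁ < c₀ + w₀ → suc w₁ ≤ w₀ + (c₀ ∸ c₁)
  <-gap⇒ {c₀} {c₁} {w₀} {w₁} c₁≤c₀ h =
    subst (suc w₁ ≤_) (+-comm (c₀ ∸ c₁) w₀)
      (+-cancelˡ-≤ c₁ _ _ (subst₂ _≤_ (sym (+-suc c₁ w₁))
        (trans (cong (_+ w₀) (sym (m+[n∸m]≡n c₁≤c₀))) (+-assoc c₁ (c₀ ∸ c₁) w₀)) h))

  ⇒<-gap : ∀ {c₀ c₁ w₀ w₁} → c₁ ≤ c₀ → suc w₁ ≤ w₀ + (c₀ ∸ c₁) → c₁ + w₁ < c₀ + w₀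
  ⇒<-gap {c₀} {c₁} {w₀} {w₁} c₁≤c₀ h =
    subst₂ _≤_ (+-suc c₁ w₁)
        (trans (sym (+-assoc c₁ (c₀ ∸ c₁) w₀)) (cong (_+ w₀) (m+[n∸m]≡n c₁≤c₀)))
        (+-monoʳ-≤ c₁ (subst (suc w₁ ≤_) (+-comm w₀ (c₀ ∸ c₁)) h))

  bind-just : ∀ {A B : Set} (mb : Maybe A) {f : A → Maybe B} {b} → (mb >>= f) ≡ just b →
    ∃ λ a → mb ≡ just a × f a ≡ just b
  bind-just (just a) eq = a , refl , eq

  act-spec : ∀ x λ′ {μ} → IsPartition λ′ → act x λ′ ≡ just μ →
    IsPartition μ × ColumnsAdd μ λ′ x × Fits x λ′
  act-spec [] λ′ isP refl = isP , (λ j → sym (+-identityʳ _)) , (λ k → +≤+ z≤n)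
  act-spec (a ∷ x) λ′ {μ} isP eq with bind-just (act x λ′) eq
  ... | ν , eqν , eqμ with act-spec x λ′ isP eqν
  ...   | isPν , columnsν , fitsx with addBox-spec a ν isPν eqμ
  ...     | canAdd , isPμ , columnsμ = isPμ , columns , fits
    where
    columns : ColumnsAdd μ λ′ (a ∷ x)
    columns j = trans (columnsμ j) (trans (cong (_+ count j (a ∷ [])) (columnsν j))
              (trans (+-assoc (colLen j λ′) _ _)
                (cong (λ v → colLen j λ′ + v) (trans (+-comm (count j x) _) (sym (count-∷ j a x))))))
    headFits : ∀ k → count (suc k) (a ∷ x) ≤ count k (a ∷ x) + (colLen k λ′ ∸ colLen (suc k) λ′)
    headFits k with a ≟ suc k
    ... | yes refl = subst (λ v → suc (count (suc k) x) ≤ v + _)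
                       (sym (count-≢ x (λ 1+k≡k → <-irrefl (sym 1+k≡k) (n<1+n k))))
                       (<-gap⇒ (colLen-antitone k λ′) (subst₂ _<_ (columnsν (suc k)) (columnsν k) canAdd))
    ... | no _ = ≤-trans (⊖≤⇒≤+ _ _ _ (ℤP.≤-trans (α-head k x) (fitsx k)))
                   (+-monoˡ-≤ _ (subst (count k x ≤_) (sym (count-∷ k a x)) (m≤n+m _ _)))
    fits : Fits (a ∷ x) λ′
    fits k = ℤP.⊔-lub (≤+⇒⊖≤ _ _ _ (headFits k)) (fitsx k)

  act-defined : ∀ x λ′ → IsPartition λ′ → Fits x λ′ → ∃ λ μ → act x λ′ ≡ just μ
  act-defined [] λ′ isP fits = λ′ , refl
  act-defined (a ∷ x) λ′ isP fits with act-defined x λ′ isP (λ k → ℤP.≤-trans (α-tail k a x) (fits k))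
  ... | ν , eqν with act-spec x λ′ isP eqν
  ...   | isPν , columnsν , _ with addBox-defined a ν isPν (canAdd a fits)
    where
    canAdd : ∀ b → Fits (b ∷ x) λ′ → CanAdd b ν
    canAdd zero _ = tt
    canAdd (suc k) fits = subst₂ _<_ (sym (columnsν (suc k))) (sym (columnsν k))
      (⇒<-gap (colLen-antitone k λ′)
        (subst₂ (λ u v → u ≤ v + _) (count-≡ (suc k) x) (count-≢ x (λ 1+k≡k → <-irrefl (sym 1+k≡k) (n<1+n k)))
          (⊖≤⇒≤+ _ _ _ (ℤP.≤-trans (α-head k (suc k ∷ x)) (fits k)))))
  ...     | μ , eqμ = μ , trans (cong (_>>= addBox a) eqν) eqμ

  columns-determine : ∀ λ′ μ → IsPartition λ′ → IsPartition μ → (∀ j → colLen j λ′ ≡ colLen j μ) → λ′ ≡ μ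
  columns-determine [] [] _ _ _ = refl
  columns-determine [] (q ∷ qs) _ (q>0 ∷ _ , _) same = ⊥-elim (0≢1+n (trans (same 0) (colLen-< qs q>0)))
  columns-determine (p ∷ ps) [] (p>0 ∷ _ , _) _ same = ⊥-elim (0≢1+n (trans (sym (same 0)) (colLen-< ps p>0)))
  columns-determine (p ∷ ps) (q ∷ qs) (_ ∷ posp , lkp) (_ ∷ posq , lkq) same with <-cmp p q
  ... | tri< p<q _ _ = ⊥-elim (0≢1+n (trans (sym (colLen-short (p ∷ ps) (≤-refl ∷ head-bounds lkp)))
                                             (trans (same p) (colLen-< qs p<q))))
  ... | tri> _ _ q<p = ⊥-elim (0≢1+n (trans (sym (colLen-short (q ∷ qs) (≤-refl ∷ head-bounds lkq)))
                                             (trans (sym (same q)) (colLen-< ps q<p))))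
  ... | tri≈ _ refl _ = cong (p ∷_) (columns-determine ps qs (posp , Linked.tail lkp) (posq , Linked.tail lkq) sameTail)
    where
    sameTail : ∀ j → colLen j ps ≡ colLen j qs
    sameTail j with j <? p | same j
    ... | yes _ | eq = suc-injective eq
    ... | no _ | eq = eq

  -- If α(x) = α(y) and w(x) = w(y) then u_x λ ≠ 0 forces u_y λ = u_x λ: y fits λ as x does,
  -- and both images have the same column lengths.
  act-image-agrees : ∀ x y λ′ {μ} → IsPartition λ′ → (∀ i → α i x ≡ α i y) → (∀ i → w i x ≡ w i y) →
    act x λ′ ≡ just μ → act y λ′ ≡ just μ
  act-image-agrees x y λ′ isP αx≡αy wx≡wy eqx with act-spec x λ′ isP eqx
  ... | isPμ , columnsx , fitsx with act-defined y λ′ isP (λ k → subst (_≤ℤ _) (αx≡αy k) (fitsx k))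
  ...   | μ′ , eqy with act-spec y λ′ isP eqy
  ...     | isPμ′ , columnsy , _ = trans eqy (cong just (columns-determine μ′ _ isPμ′ isPμ
             (λ j → trans (columnsy j) (trans (cong (λ v → colLen j λ′ + v) (sym (wx≡wy j))) (sym (columnsx j))))))

  act-invariant : ∀ x y λ′ → IsPartition λ′ → (∀ i → α i x ≡ α i y) → (∀ i → w i x ≡ w i y) →
    act x λ′ ≡ act y λ′
  act-invariant x y λ′ isP αx≡αy wx≡wy with act x λ′ in eqx | act y λ′ in eqy
  ... | just μ | _ = trans (sym (act-image-agrees x y λ′ isP αx≡αy wx≡wy eqx)) eqy
  ... | nothing | just μ′
    with () ← trans (sym eqx) (act-image-agrees y x λ′ isP (λ i → sym (αx≡αy i)) (λ i → sym (wx≡wy i)) eqy)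
  ... | nothing | nothing = refl

  -- widen d λ prepends a column of length (length λ + d) to λ.
  widen : ℕ → List ℕ → List ℕ
  widen d ps = map suc ps ++ replicate d 1

  ones-bounded : ∀ {p} d → All (_≤ suc p) (replicate d 1)
  ones-bounded zero = []
  ones-bounded (suc d) = s≤s z≤n ∷ ones-bounded d

  widen-bounded : ∀ {p} ps d → All (_≤ p) ps → All (_≤ suc p) (widen d ps)
  widen-bounded [] d [] = ones-bounded d
  widen-bounded (q ∷ qs) d (q≤p ∷ qs≤p) = s≤s q≤p ∷ widen-bounded qs d qs≤p

  widen-isPartition : ∀ ps d → IsPartition ps → IsPartition (widen d ps)
  widen-isPartition [] zero _ = [] , []
  widen-isPartition [] (suc d) _ = (s≤s z≤n ∷ proj₁ rest) , cons-linked (ones-bounded d) (proj₂ rest)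
    where
    rest : IsPartition (widen d [])
    rest = widen-isPartition [] d ([] , [])
  widen-isPartition (p ∷ ps) d (_ ∷ pos , lk) =
    (s≤s z≤n ∷ proj₁ rest) , cons-linked (widen-bounded ps d (head-bounds lk)) (proj₂ rest)
    where
    rest : IsPartition (widen d ps)
    rest = widen-isPartition ps d (pos , Linked.tail lk)

  colLen-widen : ∀ j ps d → colLen (suc j) (widen d ps) ≡ colLen j ps
  colLen-widen j [] d = colLen-short (replicate d 1) (ones-bounded d)
  colLen-widen j (p ∷ ps) d with j <? p
  ... | yes j<p = trans (colLen-< _ (s≤s j<p)) (cong suc (colLen-widen j ps d))
  ... | no j≮p = trans (colLen-≮ _ (λ 1+j<1+p → j≮p (≤-pred 1+j<1+p))) (colLen-widen j ps d)

  colLen-first : ∀ ps → All (0 <_) ps → colLen 0 ps ≡ length ps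
  colLen-first [] [] = refl
  colLen-first (p ∷ ps) (p>0 ∷ pos) = trans (colLen-< ps p>0) (cong suc (colLen-first ps pos))

  -- staircase n g: the partition with λ'_k − λ'_{k+1} = g k for k < n and no column beyond n.
  staircase : ℕ → (ℕ → ℕ) → List ℕ
  staircase zero g = []
  staircase (suc n) g = widen (g 0) (staircase n (λ k → g (suc k)))

  staircase-isPartition : ∀ n g → IsPartition (staircase n g)
  staircase-isPartition zero g = [] , []
  staircase-isPartition (suc n) g = widen-isPartition _ (g 0) (staircase-isPartition n (λ k → g (suc k)))

  staircase-column : ∀ n g j → j < n → colLen j (staircase n g) ≡ g j + colLen (suc j) (staircase n g)
  staircase-column (suc n) g zero _ = begin
    colLen 0 (widen (g 0) R)                 ≡⟨ colLen-first _ (proj₁ (staircase-isPartition (suc n) g)) ⟩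
    length (map suc R ++ replicate (g 0) 1)  ≡⟨ length-++ (map suc R) ⟩
    length (map suc R) + length (replicate (g 0) 1) ≡⟨ cong₂ _+_ (length-map suc R) (length-replicate (g 0)) ⟩
    length R + g 0                           ≡⟨ +-comm _ (g 0) ⟩
    g 0 + length R                           ≡⟨ cong (λ v → g 0 + v) (sym (colLen-first R (proj₁ (staircase-isPartition n _)))) ⟩
    g 0 + colLen 0 R                         ≡⟨ cong (λ v → g 0 + v) (sym (colLen-widen 0 R (g 0))) ⟩
    g 0 + colLen 1 (widen (g 0) R)           ∎
    where
    open ≡-Reasoning
    R : List ℕ
    R = staircase n (λ k → g (suc k))
  staircase-column (suc n) g (suc j) (s≤s j<n) = begin
    colLen (suc j) (widen (g 0) R)           ≡⟨ colLen-widen j R (g 0) ⟩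
    colLen j R                               ≡⟨ staircase-column n (λ k → g (suc k)) j j<n ⟩
    g (suc j) + colLen (suc j) R             ≡⟨ cong (λ v → g (suc j) + v) (sym (colLen-widen (suc j) R (g 0))) ⟩
    g (suc j) + colLen (suc (suc j)) (widen (g 0) R) ∎
    where
    open ≡-Reasoning
    R : List ℕ
    R = staircase n (λ k → g (suc k))

  staircase-beyond : ∀ n g j → n ≤ j → colLen j (staircase n g) ≡ 0
  staircase-beyond zero g j _ = refl
  staircase-beyond (suc n) g (suc j) (s≤s n≤j) =
    trans (colLen-widen j (staircase n (λ k → g (suc k))) (g 0)) (staircase-beyond n (λ k → g (suc k)) j n≤j)

  staircase-gap : ∀ n g j → j < n → colLen j (staircase n g) ∸ colLen (suc j) (staircase n g) ≡ g j
  staircase-gap n g j j<n =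
    trans (cong (_∸ colLen (suc j) (staircase n g)) (staircase-column n g j j<n)) (m+n∸n≡m (g j) (colLen (suc j) (staircase n g)))

  staircase-gap-beyond : ∀ n g j → n ≤ j → colLen j (staircase n g) ∸ colLen (suc j) (staircase n g) ≡ 0
  staircase-gap-beyond n g j n≤j =
    trans (cong (_∸ colLen (suc j) (staircase n g)) (staircase-beyond n g j n≤j)) (0∸n≡0 (colLen (suc j) (staircase n g)))

  Λ : ℕ → Word → List ℕ
  Λ N x = staircase N (λ k → ∣ α k x ∣)

  Λ-isPartition : ∀ N x → IsPartition (Λ N x)
  Λ-isPartition N x = staircase-isPartition N _

  fits-Λ : ∀ N x → All (_< N) x → Fits x (Λ N x)
  fits-Λ N x x<N k with k <? N
  ... | yes k<N = subst (λ d → α k x ≤ℤ + d) (sym (staircase-gap N _ k k<N)) (ℤP.≤-reflexive (sym (α-abs k x)))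
  ... | no k≮N = subst (λ d → α k x ≤ℤ + d) (sym (staircase-gap-beyond N _ k (≮⇒≥ k≮N)))
                   (ℤP.≤-reflexive (α-vanishes k x (All.map (λ a<N → ≤-trans (<⇒≤ a<N) (≮⇒≥ k≮N)) x<N)))

  Σ< : ℕ → (ℕ → ℕ) → ℕ
  Σ< zero g = 0
  Σ< (suc n) g = g n + Σ< n g

  Σ<-mono : ∀ n {g h : ℕ → ℕ} → (∀ k → k < n → g k ≤ h k) → Σ< n g ≤ Σ< n h
  Σ<-mono zero g≤h = z≤n
  Σ<-mono (suc n) g≤h = +-mono-≤ (g≤h n (n<1+n n)) (Σ<-mono n (λ k k<n → g≤h k (m<n⇒m<1+n k<n)))

  Σ<-tight : ∀ n {g h : ℕ → ℕ} → (∀ k → k < n → g k ≤ h k) → Σ< n h ≤ Σ< n g → ∀ k → k < n → g k ≡ h k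
  Σ<-tight (suc n) {g} {h} g≤h Σh≤Σg k k<1+n with m<1+n⇒m<n∨m≡n k<1+n
  ... | inj₁ k<n = Σ<-tight n g≤h′ Σ′h≤Σ′g k k<n
    where
    g≤h′ : ∀ k → k < n → g k ≤ h k
    g≤h′ k k<n = g≤h k (m<n⇒m<1+n k<n)
    Σ′h≤Σ′g : Σ< n h ≤ Σ< n g
    Σ′h≤Σ′g = +-cancelˡ-≤ (h n) _ _ (≤-trans Σh≤Σg (+-monoˡ-≤ (Σ< n g) (g≤h n (n<1+n n))))
  ... | inj₂ refl = ≤-antisym (g≤h n (n<1+n n))
                      (+-cancelʳ-≤ (Σ< n h) _ _ (≤-trans Σh≤Σg (+-monoʳ-≤ (g n)
                        (Σ<-mono n (λ k k<n → g≤h k (m<n⇒m<1+n k<n))))))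

  αSize : ℕ → Word → ℕ
  αSize N y = Σ< N (λ k → ∣ α k y ∣)

  -- The weight is read off the columns of the image, and
  -- y fitting Λ_x bounds α(y) by α(x) pointwise, which Σ<-tight turns into equality.
  Λ-rigidity : ∀ N x y {μ} → All (_< N) x → act x (Λ N x) ≡ just μ → act y (Λ N x) ≡ just μ →
    αSize N x ≤ αSize N y → (∀ i → α i y ≡ α i x) × (∀ i → w i y ≡ w i x)
  Λ-rigidity N x y x<N eqx eqy sizex≤sizey
    with act-spec x (Λ N x) (Λ-isPartition N x) eqx | act-spec y (Λ N x) (Λ-isPartition N x) eqy
  ... | _ , columnsx , _ | _ , columnsy , fitsy = sameα , sameWeight
    where
    sameWeight : ∀ i → w i y ≡ w i x
    sameWeight i = +-cancelˡ-≡ (colLen i (Λ N x)) _ _ (trans (sym (columnsy i)) (columnsx i))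
    αy≤αx : ∀ k → k < N → ∣ α k y ∣ ≤ ∣ α k x ∣
    αy≤αx k k<N = ℤP.drop‿+≤+ (subst₂ _≤ℤ_ (sym (α-abs k y)) (cong +_ (staircase-gap N _ k k<N)) (fitsy k))
    sameα : ∀ i → α i y ≡ α i x
    sameα i with i <? N
    ... | yes i<N = trans (sym (α-abs i y)) (trans (cong +_ (Σ<-tight N αy≤αx sizex≤sizey i i<N)) (α-abs i x))
    ... | no i≮N = trans (ℤP.≤-antisym (subst (λ d → α i y ≤ℤ + d) (staircase-gap-beyond N _ i (≮⇒≥ i≮N)) (fitsy i))
                                       (α-nonneg i y))
                         (sym (α-vanishes i x (All.map (λ a<N → ≤-trans (<⇒≤ a<N) (≮⇒≥ i≮N)) x<N)))

  act-++ : ∀ x y λ′ → act (x ++ y) λ′ ≡ (act y λ′ >>= act x)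
  act-++ [] y λ′ with act y λ′
  ... | just _ = refl
  ... | nothing = refl
  act-++ (a ∷ x) y λ′ with act y λ′ | act-++ x y λ′
  ... | just ν | eq = cong (_>>= addBox a) eq
  ... | nothing | eq = cong (_>>= addBox a) eq

module Annihilator {c ℓ : Level} (K : Char0Field c ℓ) where

  open Shapes
  open import Level using (lift)
  open import Data.Nat using (ℕ; suc; _≤_; _<_; s≤s)
  import Data.Nat.Properties as ℕP
  open import Data.List using (List; []; _∷_; _++_; map; concatMap; filter; length; deduplicate)
  open import Data.List.Properties using (filter-notAll) renaming (≡-dec to ≡-decList)
  open import Data.List.Extrema.Nat using (max; xs≤max; argmin; argmin-sel; f[argmin]≤f[⊤]; f[argmin]≤f[xs])
  open import Data.List.Membership.Propositional using (_∈_)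
  open import Data.List.Membership.Propositional.Properties
    using (∈-++⁺ˡ; ∈-++⁺ʳ; ∈-map⁺; ∈-map⁻; ∈-deduplicate⁺; ∈-deduplicate⁻; ∈-filter⁻; ∈-concatMap⁺)
  open import Data.List.Relation.Unary.All as All using (All; []; _∷_)
  open import Data.List.Relation.Unary.Any as Any using (here; there)
  open import Data.List.Relation.Unary.Unique.Propositional using (Unique)
  open import Data.List.Relation.Unary.AllPairs using (_∷_)
  open import Data.List.Relation.Unary.Unique.DecPropositional.Properties using (deduplicate-!)
  open import Data.Maybe using (Maybe; just; nothing; _>>=_)
  open import Data.Maybe.Properties using () renaming (≡-dec to ≡-decMaybe)
  open import Data.Product using (_,_; proj₁; proj₂; ∃)
  open import Data.Sum using ([_,_]′)
  open import Data.Empty using (⊥; ⊥-elim)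
  open import Function using (_∘_)
  open import Relation.Nullary using (¬_; Dec; yes; no; ¬?)
  open import Relation.Unary using (Decidable)
  open import Relation.Binary.Definitions using (DecidableEquality)
  import Relation.Binary.PropositionalEquality as P

  open Char0Field K renaming (refl to ≈refl; sym to ≈sym; trans to ≈trans)
  open Over K
  open import Relation.Binary.Reasoning.Setoid setoid
  open import Algebra.Properties.CommutativeSemigroup +-commutativeSemigroup using (interchange)

  _≟W_ : DecidableEquality Word
  _≟W_ = ≡-decList ℕP._≟_

  _≟M_ : DecidableEquality (Maybe (List ℕ))
  _≟M_ = ≡-decMaybe _≟W_

  sumBy : ∀ {a} {A : Set a} → (A → Carrier) → List A → Carrier
  sumBy g l = ΣK (map g l)

  sumBy-congAll : ∀ {a} {A : Set a} {g h : A → Carrier} {l} → All (λ x → g x ≈ h x) l → sumBy g l ≈ sumBy h l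
  sumBy-congAll [] = ≈refl
  sumBy-congAll (e ∷ es) = +-cong e (sumBy-congAll es)

  sumBy-cong : ∀ {a} {A : Set a} {g h : A → Carrier} l → (∀ x → g x ≈ h x) → sumBy g l ≈ sumBy h l
  sumBy-cong l e = sumBy-congAll (All.universal e l)

  sumBy-vanishes : ∀ {a} {A : Set a} {g : A → Carrier} {l} → All (λ x → g x ≈ 0#) l → sumBy g l ≈ 0#
  sumBy-vanishes [] = ≈refl
  sumBy-vanishes (e ∷ es) = ≈trans (+-cong e (sumBy-vanishes es)) (+-identityʳ 0#)

  sumBy-0 : ∀ {a} {A : Set a} (l : List A) → sumBy (λ _ → 0#) l ≈ 0#
  sumBy-0 l = sumBy-vanishes (All.universal (λ _ → ≈refl) l)

  sumBy-+ : ∀ {a} {A : Set a} (g h : A → Carrier) l → sumBy (λ x → g x + h x) l ≈ sumBy g l + sumBy h l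
  sumBy-+ g h [] = ≈sym (+-identityʳ 0#)
  sumBy-+ g h (x ∷ l) = ≈trans (+-congˡ (sumBy-+ g h l)) (interchange _ _ _ _)

  sumBy-++ : ∀ {a} {A : Set a} (g : A → Carrier) l l′ → sumBy g (l ++ l′) ≈ sumBy g l + sumBy g l′
  sumBy-++ g [] l′ = ≈sym (+-identityˡ _)
  sumBy-++ g (x ∷ l) l′ = ≈trans (+-congˡ (sumBy-++ g l l′)) (≈sym (+-assoc _ _ _))

  sumBy-*ˡ : ∀ {a} {A : Set a} (g : A → Carrier) z l → sumBy (λ x → z * g x) l ≈ z * sumBy g l
  sumBy-*ˡ g z [] = ≈sym (zeroʳ z)
  sumBy-*ˡ g z (x ∷ l) = ≈trans (+-congˡ (sumBy-*ˡ g z l)) (≈sym (distribˡ _ _ _))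

  sumBy-*ʳ : ∀ {a} {A : Set a} (g : A → Carrier) z l → sumBy (λ x → g x * z) l ≈ sumBy g l * z
  sumBy-*ʳ g z [] = ≈sym (zeroˡ z)
  sumBy-*ʳ g z (x ∷ l) = ≈trans (+-congˡ (sumBy-*ʳ g z l)) (≈sym (distribʳ _ _ _))

  sumBy-map : ∀ {a b} {A : Set a} {B : Set b} (g : B → Carrier) (k : A → B) l → sumBy g (map k l) P.≡ sumBy (g ∘ k) l
  sumBy-map g k [] = P.refl
  sumBy-map g k (x ∷ l) = P.cong (g (k x) +_) (sumBy-map g k l)

  sumBy-concatMap : ∀ {a b} {A : Set a} {B : Set b} (g : B → Carrier) (k : A → List B) l →
    sumBy g (concatMap k l) ≈ sumBy (λ x → sumBy g (k x)) l
  sumBy-concatMap g k [] = ≈refl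
  sumBy-concatMap g k (x ∷ l) = ≈trans (sumBy-++ g (k x) (concatMap k l)) (+-congˡ (sumBy-concatMap g k l))

  sumBy-swap : ∀ {a b} {A : Set a} {B : Set b} (F : A → B → Carrier) l₁ l₂ →
    sumBy (λ x → sumBy (F x) l₂) l₁ ≈ sumBy (λ y → sumBy (λ x → F x y) l₁) l₂
  sumBy-swap F [] l₂ = ≈sym (sumBy-0 l₂)
  sumBy-swap F (x ∷ l₁) l₂ = ≈trans (+-congˡ (sumBy-swap F l₁ l₂)) (≈sym (sumBy-+ (F x) (λ y → sumBy (λ x → F x y) l₁) l₂))

  sumBy-filter : ∀ {a p} {A : Set a} {Q : A → Set p} (Q? : Decidable Q) (g : A → Carrier) l →
    sumBy g l ≈ sumBy g (filter Q? l) + sumBy g (filter (¬? ∘ Q?) l)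
  sumBy-filter Q? g [] = ≈sym (+-identityʳ 0#)
  sumBy-filter Q? g (x ∷ l) with Q? x
  ... | yes _ = ≈trans (+-congˡ (sumBy-filter Q? g l)) (≈sym (+-assoc _ _ _))
  ... | no _ = ≈trans (+-congˡ (sumBy-filter Q? g l)) (≈trans (≈sym (+-assoc _ _ _))
                 (≈trans (+-congʳ (+-comm _ _)) (+-assoc _ _ _)))

  when : ∀ {p} {Q : Set p} → Dec Q → Carrier → Carrier
  when (yes _) x = x
  when (no _) x = 0#

  when-yes : ∀ {p} {Q : Set p} (d : Dec Q) {x} → Q → when d x ≈ x
  when-yes (yes _) _ = ≈refl
  when-yes (no ¬q) q = ⊥-elim (¬q q)

  when-no : ∀ {p} {Q : Set p} (d : Dec Q) {x} → ¬ Q → when d x ≈ 0#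
  when-no (yes q) ¬q = ⊥-elim (¬q q)
  when-no (no _) _ = ≈refl

  when-cong : ∀ {p} {Q : Set p} (d : Dec Q) {x y} → x ≈ y → when d x ≈ when d y
  when-cong (yes _) e = e
  when-cong (no _) e = ≈refl

  when-0 : ∀ {p} {Q : Set p} (d : Dec Q) {x} → x ≈ 0# → when d x ≈ 0#
  when-0 (yes _) e = e
  when-0 (no _) e = ≈refl

  when-sumBy : ∀ {p a} {Q : Set p} {A : Set a} (d : Dec Q) (g : A → Carrier) l →
    when d (sumBy g l) ≈ sumBy (λ x → when d (g x)) l
  when-sumBy (yes _) g l = ≈refl
  when-sumBy (no _) g l = ≈sym (sumBy-0 l)

  when-*ˡ : ∀ {p} {Q : Set p} (d : Dec Q) x y → when d (x * y) ≈ x * when d y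
  when-*ˡ (yes _) x y = ≈refl
  when-*ˡ (no _) x y = ≈sym (zeroʳ x)

  when-*ʳ : ∀ {p} {Q : Set p} (d : Dec Q) x y → when d (x * y) ≈ when d x * y
  when-*ʳ (yes _) x y = ≈refl
  when-*ʳ (no _) x y = ≈sym (zeroˡ y)

  sum-filtered : ∀ {p} {Q : Carrier × Word → Set p} (Q? : Decidable Q) f →
    ΣK (map proj₁ (filter Q? f)) ≈ sumBy (λ t → when (Q? t) (proj₁ t)) f
  sum-filtered Q? [] = ≈refl
  sum-filtered Q? (t ∷ f) with Q? t
  ... | yes _ = +-congˡ (sum-filtered Q? f)
  ... | no _ = ≈trans (sum-filtered Q? f) (≈sym (+-identityˡ _))

  pick-unique : ∀ {A : Set} (_≟A_ : DecidableEquality A) {Q : A → Set} (Q? : Decidable Q) {a : A} x D →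
    Unique D → a ∈ D → sumBy (λ z → when (Q? z) (when (a ≟A z) x)) D ≈ when (Q? a) x
  pick-unique _≟A_ Q? {a} x (z ∷ D) (a∉D ∷ uniqueD) a∈ with a ≟A z
  ... | yes P.refl = ≈trans (+-congˡ (sumBy-vanishes (All.map (λ a≢ → when-0 (Q? _) (when-no (a ≟A _) a≢)) a∉D)))
                       (+-identityʳ _)
  ... | no a≢z with a∈
  ...   | here a≡z = ⊥-elim (a≢z a≡z)
  ...   | there a∈D = ≈trans (+-congʳ (when-0 (Q? z) ≈refl)) (≈trans (+-identityˡ _) (pick-unique _≟A_ Q? x D uniqueD a∈D))

  group-by : ∀ {A : Set} (_≟A_ : DecidableEquality A) (key : Word → A) {Q : A → Set} (Q? : Decidable Q)
    (D : List A) → Unique D → (f : U) → All (λ t → key (proj₂ t) ∈ D) f →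
    sumBy (λ t → when (Q? (key (proj₂ t))) (proj₁ t)) f ≈
    sumBy (λ z → when (Q? z) (sumBy (λ t → when (key (proj₂ t) ≟A z) (proj₁ t)) f)) D
  group-by _≟A_ key Q? D uniqueD f keys∈D = ≈sym (begin
    sumBy (λ z → when (Q? z) (sumBy (λ t → when (key (proj₂ t) ≟A z) (proj₁ t)) f)) D
      ≈⟨ sumBy-cong D (λ z → when-sumBy (Q? z) _ f) ⟩
    sumBy (λ z → sumBy (λ t → when (Q? z) (when (key (proj₂ t) ≟A z) (proj₁ t))) f) D
      ≈⟨ ≈sym (sumBy-swap (λ t z → when (Q? z) (when (key (proj₂ t) ≟A z) (proj₁ t))) f D) ⟩
    sumBy (λ t → sumBy (λ z → when (Q? z) (when (key (proj₂ t) ≟A z) (proj₁ t))) D) f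
      ≈⟨ sumBy-congAll (All.map (λ {t} k∈D → pick-unique _≟A_ Q? (proj₁ t) D uniqueD k∈D) keys∈D) ⟩
    sumBy (λ t → when (Q? (key (proj₂ t))) (proj₁ t)) f ∎)

  imageCoeff : U → List ℕ → List ℕ → Carrier
  imageCoeff f λ′ μ = sumBy (λ t → when (act (proj₂ t) λ′ ≟M just μ) (proj₁ t)) f

  wordCoeff : U → Word → Carrier
  wordCoeff f z = sumBy (λ t → when (proj₂ t ≟W z) (proj₁ t)) f

  actCoeff≈ : ∀ f λ′ μ → actCoeff f λ′ μ ≈ imageCoeff f λ′ μ
  actCoeff≈ f λ′ μ = sum-filtered (λ t → act (proj₂ t) λ′ ≟M just μ) f

  coeff≈ : ∀ f z → coeff f z ≈ wordCoeff f z
  coeff≈ f z = sum-filtered (λ t → proj₂ t ≟W z) f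

  sumBy-*U : ∀ (G : Carrier × Word → Carrier) a f →
    sumBy G (a *U f) ≈ sumBy (λ s → sumBy (λ t → G (proj₁ s * proj₁ t , proj₂ s ++ proj₂ t)) f) a
  sumBy-*U G a f = ≈trans (sumBy-concatMap G _ a) (sumBy-cong a (λ s → reflexive (sumBy-map G _ f)))

  generator∈I : ∀ x y → (∀ i → α i x P.≡ α i y) → (∀ i → w i x P.≡ w i y) → InI (diff x y)
  generator∈I x y αx≡αy wx≡wy λ′ isP μ _ = ≈trans (actCoeff≈ (diff x y) λ′ μ) (cancel (act x λ′ ≟M just μ))
    where
    same : act x λ′ P.≡ act y λ′
    same = act-invariant x y λ′ isP αx≡αy wx≡wy
    cancel : Dec (act x λ′ P.≡ just μ) → imageCoeff (diff x y) λ′ μ ≈ 0#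
    cancel (yes hit) = ≈trans (+-cong (when-yes (act x λ′ ≟M just μ) hit)
                         (+-congʳ (when-yes (act y λ′ ≟M just μ) (P.trans (P.sym same) hit))))
                         (≈trans (+-congˡ (+-identityʳ _)) (-‿inverseʳ 1#))
    cancel (no miss) = ≈trans (+-cong (when-no (act x λ′ ≟M just μ) miss)
                         (+-congʳ (when-no (act y λ′ ≟M just μ) (λ hit → miss (P.trans same hit)))))
                         (≈trans (+-congˡ (+-identityʳ 0#)) (+-identityʳ 0#))

  I-+ : ∀ f g → InI f → InI g → InI (f +U g)
  I-+ f g f∈I g∈I λ′ isP μ isPμ = begin
    actCoeff (f ++ g) λ′ μ                   ≈⟨ actCoeff≈ (f ++ g) λ′ μ ⟩
    imageCoeff (f ++ g) λ′ μ                 ≈⟨ sumBy-++ _ f g ⟩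
    imageCoeff f λ′ μ + imageCoeff g λ′ μ    ≈⟨ +-cong (≈trans (≈sym (actCoeff≈ f λ′ μ)) (f∈I λ′ isP μ isPμ))
                                                       (≈trans (≈sym (actCoeff≈ g λ′ μ)) (g∈I λ′ isP μ isPμ)) ⟩
    0# + 0#                                  ≈⟨ +-identityʳ 0# ⟩
    0# ∎

  -- f λ depends only on the coefficients of f: group the terms of f and g by word.
  I-resp : ∀ f g → f ≈U g → InI f → InI g
  I-resp f g f≈g f∈I λ′ isP μ isPμ = begin
    actCoeff g λ′ μ                          ≈⟨ actCoeff≈ g λ′ μ ⟩
    imageCoeff g λ′ μ                        ≈⟨ group-by _≟W_ (λ y → y) Q? D uniqueD g (All.tabulate (λ t∈ → inD (∈-++⁺ʳ f t∈))) ⟩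
    sumBy (λ z → when (Q? z) (wordCoeff g z)) D
      ≈⟨ sumBy-cong D (λ z → when-cong (Q? z) (≈trans (≈sym (coeff≈ g z)) (≈trans (≈sym (f≈g z)) (coeff≈ f z)))) ⟩
    sumBy (λ z → when (Q? z) (wordCoeff f z)) D
      ≈⟨ ≈sym (group-by _≟W_ (λ y → y) Q? D uniqueD f (All.tabulate (λ t∈ → inD (∈-++⁺ˡ t∈)))) ⟩
    imageCoeff f λ′ μ                        ≈⟨ ≈sym (actCoeff≈ f λ′ μ) ⟩
    actCoeff f λ′ μ                          ≈⟨ f∈I λ′ isP μ isPμ ⟩
    0# ∎
    where
    Q? : (z : Word) → Dec (act z λ′ P.≡ just μ)
    Q? z = act z λ′ ≟M just μ
    D : List Word
    D = deduplicate _≟W_ (map proj₂ (f ++ g))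
    uniqueD : Unique D
    uniqueD = deduplicate-! _≟W_ (map proj₂ (f ++ g))
    inD : ∀ {t} → t ∈ f ++ g → proj₂ t ∈ D
    inD t∈ = ∈-deduplicate⁺ _≟W_ (∈-map⁺ proj₂ t∈)

  -- For f ∈ I, every u_x f annihilates: group the terms of f by the value u_t λ.
  I-prefixed : ∀ f → InI f → ∀ λ′ → IsPartition λ′ → ∀ μ x →
    sumBy (λ t → when (act (x ++ proj₂ t) λ′ ≟M just μ) (proj₁ t)) f ≈ 0#
  I-prefixed f f∈I λ′ isP μ x = begin
    sumBy (λ t → when (act (x ++ proj₂ t) λ′ ≟M just μ) (proj₁ t)) f
      ≈⟨ reflexive (sumBy-ext f) ⟩
    sumBy (λ t → when (Q? (act (proj₂ t) λ′)) (proj₁ t)) f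
      ≈⟨ group-by _≟M_ (λ y → act y λ′) Q? D uniqueD f (All.tabulate inD) ⟩
    sumBy (λ z → when (Q? z) (sumBy (λ t → when (act (proj₂ t) λ′ ≟M z) (proj₁ t)) f)) D
      ≈⟨ sumBy-vanishes (All.tabulate vanishes) ⟩
    0# ∎
    where
    Q? : (z : Maybe (List ℕ)) → Dec ((z >>= act x) P.≡ just μ)
    Q? z = (z >>= act x) ≟M just μ
    D : List (Maybe (List ℕ))
    D = deduplicate _≟M_ (map (λ t → act (proj₂ t) λ′) f)
    uniqueD : Unique D
    uniqueD = deduplicate-! _≟M_ (map (λ t → act (proj₂ t) λ′) f)
    inD : ∀ {t} → t ∈ f → act (proj₂ t) λ′ ∈ D
    inD t∈ = ∈-deduplicate⁺ _≟M_ (∈-map⁺ (λ t → act (proj₂ t) λ′) t∈)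
    sumBy-ext : ∀ g → sumBy (λ t → when (act (x ++ proj₂ t) λ′ ≟M just μ) (proj₁ t)) g P.≡
                      sumBy (λ t → when (Q? (act (proj₂ t) λ′)) (proj₁ t)) g
    sumBy-ext [] = P.refl
    sumBy-ext (t ∷ g) = P.cong₂ _+_ (P.cong (λ m → when (m ≟M just μ) (proj₁ t)) (act-++ x (proj₂ t) λ′)) (sumBy-ext g)
    -- every value z = u_t λ occurring is 0 or a partition ν, and f λ has coefficient 0 at ν
    vanishes : ∀ {z} → z ∈ D → when (Q? z) (sumBy (λ t → when (act (proj₂ t) λ′ ≟M z) (proj₁ t)) f) ≈ 0#
    vanishes {nothing} _ = ≈refl
    vanishes {just ν} z∈D with ∈-map⁻ (λ t → act (proj₂ t) λ′) (∈-deduplicate⁻ _≟M_ _ z∈D)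
    ... | t , _ , eq = when-0 (Q? (just ν)) (≈trans (≈sym (actCoeff≈ f λ′ ν))
                         (f∈I λ′ isP ν (proj₁ (act-spec (proj₂ t) λ′ isP (P.sym eq)))))

  I-*ˡ : ∀ a f → InI f → InI (a *U f)
  I-*ˡ a f f∈I λ′ isP μ isPμ = begin
    actCoeff (a *U f) λ′ μ                   ≈⟨ actCoeff≈ (a *U f) λ′ μ ⟩
    imageCoeff (a *U f) λ′ μ                 ≈⟨ sumBy-*U _ a f ⟩
    sumBy (λ s → sumBy (λ t → when (act (proj₂ s ++ proj₂ t) λ′ ≟M just μ) (proj₁ s * proj₁ t)) f) a
      ≈⟨ sumBy-cong a (λ s → ≈trans (sumBy-cong f (λ t → when-*ˡ (act (proj₂ s ++ proj₂ t) λ′ ≟M just μ) _ _))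
            (≈trans (sumBy-*ˡ _ (proj₁ s) f) (≈trans (*-congˡ (I-prefixed f f∈I λ′ isP μ (proj₂ s))) (zeroʳ _)))) ⟩
    sumBy (λ _ → 0#) a                       ≈⟨ sumBy-0 a ⟩
    0# ∎

  -- For f ∈ I, f u_z annihilates: u_z λ is 0 or a partition ν, and f ν = 0.
  I-suffixed : ∀ f → InI f → ∀ λ′ → IsPartition λ′ → ∀ μ → IsPartition μ → ∀ z →
    sumBy (λ t → when (act (proj₂ t ++ z) λ′ ≟M just μ) (proj₁ t)) f ≈ 0#
  I-suffixed f f∈I λ′ isP μ isPμ z with act z λ′ in eqz
  ... | nothing = ≈trans (sumBy-cong f (λ t → when-no (act (proj₂ t ++ z) λ′ ≟M just μ) (λ hit → nothing≢just
                     (P.trans (P.sym (P.trans (act-++ (proj₂ t) z λ′) (P.cong (_>>= act (proj₂ t)) eqz))) hit))))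
                   (sumBy-0 f)
    where
    nothing≢just : ∀ {ν : List ℕ} → nothing P.≡ just ν → ⊥
    nothing≢just ()
  ... | just ν = ≈trans (reflexive (sumBy-ext f)) (≈trans (≈sym (actCoeff≈ f ν μ))
                   (f∈I ν (proj₁ (act-spec z λ′ isP eqz)) μ isPμ))
    where
    sumBy-ext : ∀ g → sumBy (λ t → when (act (proj₂ t ++ z) λ′ ≟M just μ) (proj₁ t)) g P.≡ imageCoeff g ν μ
    sumBy-ext [] = P.refl
    sumBy-ext (t ∷ g) = P.cong₂ _+_ (P.cong (λ m → when (m ≟M just μ) (proj₁ t))
                          (P.trans (act-++ (proj₂ t) z λ′) (P.cong (_>>= act (proj₂ t)) eqz))) (sumBy-ext g)

  I-*ʳ : ∀ f b → InI f → InI (f *U b)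
  I-*ʳ f b f∈I λ′ isP μ isPμ = begin
    actCoeff (f *U b) λ′ μ                   ≈⟨ actCoeff≈ (f *U b) λ′ μ ⟩
    imageCoeff (f *U b) λ′ μ                 ≈⟨ sumBy-*U _ f b ⟩
    sumBy (λ s → sumBy (λ t → F s t) b) f    ≈⟨ sumBy-swap F f b ⟩
    sumBy (λ t → sumBy (λ s → F s t) f) b
      ≈⟨ sumBy-cong b (λ t → ≈trans (sumBy-cong f (λ s → when-*ʳ (act (proj₂ s ++ proj₂ t) λ′ ≟M just μ) _ _))
            (≈trans (sumBy-*ʳ _ (proj₁ t) f) (≈trans (*-congʳ (I-suffixed f f∈I λ′ isP μ isPμ (proj₂ t))) (zeroˡ _)))) ⟩
    sumBy (λ _ → 0#) b                       ≈⟨ sumBy-0 b ⟩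
    0# ∎
    where
    F : Carrier × Word → Carrier × Word → Carrier
    F s t = when (act (proj₂ s ++ proj₂ t) λ′ ≟M just μ) (proj₁ s * proj₁ t)

  ideal⊆I : ∀ {f} → Ideal Gen f → InI f
  ideal⊆I (gen (lift (x , y , αx≡αy , wx≡wy , P.refl))) = generator∈I x y αx≡αy wx≡wy
  ideal⊆I zer λ′ isP μ isPμ = ≈refl
  ideal⊆I (add {f} {g} f∈ g∈) = I-+ f g (ideal⊆I f∈) (ideal⊆I g∈)
  ideal⊆I (lmul {f} a f∈) = I-*ˡ a f (ideal⊆I f∈)
  ideal⊆I (rmul {f} b f∈) = I-*ʳ f b (ideal⊆I f∈)
  ideal⊆I (resp {f} {g} f≈g f∈) = I-resp f g f≈g (ideal⊆I f∈)

  SameStats : Word → Word → Set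
  SameStats x y = (∀ i → α i y P.≡ α i x) × (∀ i → w i y P.≡ w i x)

  towards : Word → U → U
  towards x g = concatMap (λ t → ((proj₁ t , []) ∷ []) *U diff (proj₂ t) x) g

  towards∈ideal : ∀ x g → All (λ t → SameStats x (proj₂ t)) g → Ideal Gen (towards x g)
  towards∈ideal x [] [] = zer
  towards∈ideal x (t ∷ g) ((αy≡αx , wy≡wx) ∷ same) =
    add (lmul ((proj₁ t , []) ∷ []) (gen (lift (proj₂ t , x , αy≡αx , wy≡wx , P.refl)))) (towards∈ideal x g same)

  -- If the coefficients of g sum to 0, the u_x-parts cancel and towards x g = g.
  towards≈ : ∀ x g → ΣK (map proj₁ g) ≈ 0# → towards x g ≈U g
  towards≈ x g sum≈0 z = begin
    coeff (towards x g) z                                   ≈⟨ coeff≈ (towards x g) z ⟩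
    wordCoeff (towards x g) z                               ≈⟨ sumBy-concatMap _ _ g ⟩
    sumBy (λ t → when (proj₂ t ≟W z) (proj₁ t * 1#) + (when (x ≟W z) (proj₁ t * - 1#) + 0#)) g
      ≈⟨ sumBy-cong g (λ t → +-cong (when-cong (proj₂ t ≟W z) (*-identityʳ _)) (+-identityʳ _)) ⟩
    sumBy (λ t → when (proj₂ t ≟W z) (proj₁ t) + when (x ≟W z) (proj₁ t * - 1#)) g
      ≈⟨ sumBy-+ _ _ g ⟩
    wordCoeff g z + sumBy (λ t → when (x ≟W z) (proj₁ t * - 1#)) g
      ≈⟨ +-congˡ (≈trans (≈sym (when-sumBy (x ≟W z) _ g)) (when-0 (x ≟W z) xParts≈0)) ⟩
    wordCoeff g z + 0#                                      ≈⟨ +-identityʳ _ ⟩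
    wordCoeff g z                                           ≈⟨ ≈sym (coeff≈ g z) ⟩
    coeff g z ∎
    where
    xParts≈0 : sumBy (λ t → proj₁ t * - 1#) g ≈ 0#
    xParts≈0 = ≈trans (sumBy-*ʳ proj₁ (- 1#) g)
                 (≈trans (*-congʳ sum≈0) (zeroˡ _))

  letterBound : U → ℕ
  letterBound f = suc (max 0 (concatMap proj₂ f))

  letterBound-correct : ∀ f {t} → t ∈ f → All (_< letterBound f) (proj₂ t)
  letterBound-correct f t∈f = All.tabulate (λ a∈ →
    s≤s (All.lookup (xs≤max 0 (concatMap proj₂ f)) (∈-concatMap⁺ proj₂ (Any.map (λ { P.refl → a∈ }) t∈f))))

  -- Let t = (c , x) be a term of f ∈ I minimising αSize N.  The terms of f sending Λ_x to
  -- u_x Λ_x = M share α and w with x (Λ-rigidity) and their coefficients sum to the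
  -- coefficient of M in f Λ_x, i.e. 0; so they form towards x (…), an element of the ideal.
  hitting-terms∈ideal : ∀ f → InI f → ∀ N x → All (_< N) x → All (λ s → αSize N x ≤ αSize N (proj₂ s)) f →
    ∀ {M} (eqM : act x (Λ N x) P.≡ just M) → Ideal Gen (filter (λ s → act (proj₂ s) (Λ N x) ≟M just M) f)
  hitting-terms∈ideal f f∈I N x x<N minimal {M} eqM = resp (towards≈ x hits sum≈0) (towards∈ideal x hits same)
    where
    hit? : (s : Carrier × Word) → Dec (act (proj₂ s) (Λ N x) P.≡ just M)
    hit? s = act (proj₂ s) (Λ N x) ≟M just M
    hits : U
    hits = filter hit? f
    sum≈0 : ΣK (map proj₁ hits) ≈ 0#
    sum≈0 = f∈I (Λ N x) (Λ-isPartition N x) M (proj₁ (act-spec x (Λ N x) (Λ-isPartition N x) eqM))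
    same : All (λ s → SameStats x (proj₂ s)) hits
    same = All.tabulate (λ {s} s∈ → let s∈f , hit = ∈-filter⁻ hit? s∈ in
                                     Λ-rigidity N x (proj₂ s) x<N eqM hit (All.lookup minimal s∈f))

  filter-split≈ : ∀ {p} {Q : Carrier × Word → Set p} (Q? : Decidable Q) f → (filter Q? f ++ filter (¬? ∘ Q?) f) ≈U f
  filter-split≈ Q? f z = begin
    coeff (filter Q? f ++ filter (¬? ∘ Q?) f) z             ≈⟨ coeff≈ (filter Q? f ++ filter (¬? ∘ Q?) f) z ⟩
    wordCoeff (filter Q? f ++ filter (¬? ∘ Q?) f) z         ≈⟨ sumBy-++ _ (filter Q? f) _ ⟩
    wordCoeff (filter Q? f) z + wordCoeff (filter (¬? ∘ Q?) f) z ≈⟨ ≈sym (sumBy-filter Q? _ f) ⟩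
    wordCoeff f z                                           ≈⟨ ≈sym (coeff≈ f z) ⟩
    coeff f z ∎

  I-filter-complement : ∀ {p} {Q : Carrier × Word → Set p} (Q? : Decidable Q) f →
    InI f → InI (filter Q? f) → InI (filter (¬? ∘ Q?) f)
  I-filter-complement Q? f f∈I selected∈I λ′ isP μ isPμ = begin
    actCoeff (filter (¬? ∘ Q?) f) λ′ μ                      ≈⟨ actCoeff≈ (filter (¬? ∘ Q?) f) λ′ μ ⟩
    imageCoeff (filter (¬? ∘ Q?) f) λ′ μ                    ≈⟨ ≈sym (+-identityˡ _) ⟩
    0# + imageCoeff (filter (¬? ∘ Q?) f) λ′ μ
      ≈⟨ +-congʳ (≈sym (≈trans (≈sym (actCoeff≈ (filter Q? f) λ′ μ)) (selected∈I λ′ isP μ isPμ))) ⟩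
    imageCoeff (filter Q? f) λ′ μ + imageCoeff (filter (¬? ∘ Q?) f) λ′ μ ≈⟨ ≈sym (sumBy-filter Q? _ f) ⟩
    imageCoeff f λ′ μ                                       ≈⟨ ≈sym (actCoeff≈ f λ′ μ) ⟩
    actCoeff f λ′ μ                                         ≈⟨ f∈I λ′ isP μ isPμ ⟩
    0# ∎

  -- I lies in the ideal: induction on a bound for the number of terms, peeling off the terms
  -- hitting u_x Λ_x for an αSize-minimal term x.
  I⊆ideal-by-length : ∀ n f → length f ≤ n → InI f → Ideal Gen f
  I⊆ideal-by-length _ [] _ _ = zer
  I⊆ideal-by-length (suc n) f@(t₀ ∷ f′) (s≤s len≤n) f∈I =
    resp (filter-split≈ hit? f) (add hits∈ideal (I⊆ideal-by-length n rest rest-shorter rest∈I))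
    where
    N : ℕ
    N = letterBound f
    size : Carrier × Word → ℕ
    size s = αSize N (proj₂ s)
    t : Carrier × Word
    t = argmin size t₀ f′
    t∈f : t ∈ f
    t∈f = [ here , there ]′ (argmin-sel size t₀ f′)
    x : Word
    x = proj₂ t
    imageOfX : ∃ λ M → act x (Λ N x) P.≡ just M
    imageOfX = act-defined x (Λ N x) (Λ-isPartition N x) (fits-Λ N x (letterBound-correct f t∈f))
    hit? : (s : Carrier × Word) → Dec (act (proj₂ s) (Λ N x) P.≡ just (proj₁ imageOfX))
    hit? s = act (proj₂ s) (Λ N x) ≟M just (proj₁ imageOfX)
    hits∈ideal : Ideal Gen (filter hit? f)
    hits∈ideal = hitting-terms∈ideal f f∈I N x (letterBound-correct f t∈f)
                   (f[argmin]≤f[⊤] {f = size} t₀ f′ ∷ f[argmin]≤f[xs] {f = size} t₀ f′) (proj₂ imageOfX)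
    rest : U
    rest = filter (¬? ∘ hit?) f
    rest∈I : InI rest
    rest∈I = I-filter-complement hit? f f∈I (ideal⊆I hits∈ideal)
    rest-shorter : length rest ≤ n
    rest-shorter = ℕP.≤-pred (ℕP.≤-trans (filter-notAll (¬? ∘ hit?) f (Any.map (λ { P.refl miss → miss (proj₂ imageOfX) }) t∈f))
                                         (s≤s len≤n))

  I⊆ideal : ∀ f → InI f → Ideal Gen f
  I⊆ideal f = I⊆ideal-by-length (length f) f ℕP.≤-refl

mainTheorem5 : ∀ {c ℓ : Level} (K : Char0Field c ℓ) →
    let open Defs.Over K in
    ∀ (f : U) → (InI f → Ideal Gen f) × (Ideal Gen f → InI f)
mainTheorem5 K f = I⊆ideal f , ideal⊆I
  where open Annihilator K
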